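{- Let $x$ be the greedy solution of the PFCT-S instance. Then its cost $\sum_{i\in S,j\in T}\mathbf{1}_{x_{ij}>0}f_i$ is at most $\sum_{i=1}^n(f_i-f_{i+1})\,\pi(a([i]))+\sum_{i=2}^n f_i$.
   Context: A PFCT-S instance: sources $S=[n]$ with supplies $a_i\in\mathbb{Z}_{>0}$ and costs $f_i\ge0$ ordered so that $f_1\ge\cdots\ge f_n$; sinks $T=[m]$ with demands $b_j\in\mathbb{Z}_{>0}$ ordered so that $b_1\ge\cdots\ge b_m$; $\sum_i a_i=\sum_j b_j$. For $U$ a set of indices, $a(U)=\sum_{i\in U}a_i$, $b(U)=\sum_{j\in U}b_j$. Set $f_{n+1}=0$. For real $t\in(0,b([m])]$, $\pi(t)$ is the smallest $j$ with $b([j])\ge t$. The greedy solution is produced by: start with $x=0$, residual supplies $a'_i=a_i$, residual demands $b'_j=b_j$, and $i=j=1$; while $i\le n$ and $j\le m$: set $x_{ij}=\min\{a'_i,b'_j\}$, subtract it from $a'_i$ and $b'_j$, then if $a'_i=0$ increment $i$, and if $b'_j=0$ increment $j$.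
   Formalization: The costs $f_i$ take values in the rationals. -}

module Defs where

open import Data.Nat as ℕ using (ℕ; zero; suc; _≤_; _<_; _≤?_; _<ᵇ_; _⊓_)
open import Data.Integer using (+_)
open import Data.Rational as ℚ using (ℚ; 0ℚ; _/_)
open import Data.Fin using (Fin; toℕ)
open import Data.List using (List; []; _∷_; foldr; map; filter; head; allFin; applyUpTo; take)
open import Data.Maybe using (fromMaybe)
open import Data.Product using (_×_; _,_)
open import Data.Bool using (if_then_else_)
open import Relation.Nullary.Decidable using (does)

-- Indices are 0-based in Agda: source i : Fin n corresponds to paper's source (toℕ i + 1).

sumℕ : List ℕ → ℕ
sumℕ = foldr ℕ._+_ 0

sumℚ : List ℚ → ℚ
sumℚ = foldr ℚ._+_ 0ℚ

vals : ∀ {n} {A : Set} → (Fin n → A) → List A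
vals {n} v = map v (allFin n)

ℕ→ℚ : ℕ → ℚ
ℕ→ℚ k = + k / 1

-- A run records the assignments x_{ij} := min{a'_i, b'_j} as triples (i , j , amount),
-- with 0-based indices i, j.  'go i j a as b bs' is the loop state where the current
-- residual supply of source i is a (remaining untouched supplies: as) and the current
-- residual demand of sink j is b (remaining untouched demands: bs).

Assign : Set
Assign = ℕ × ℕ × ℕ

go : ℕ → ℕ → ℕ → List ℕ → ℕ → List ℕ → List Assign
go i j a as b bs = (i , j , a ⊓ b) ∷ next a as b bs
  where
  next : ℕ → List ℕ → ℕ → List ℕ → List Assign
  next a as b bs with a <ᵇ b | b <ᵇ a
  next a [] b bs | Data.Bool.true | _ = []
  next a (a₁ ∷ as) b bs | Data.Bool.true | _ = go (suc i) j a₁ as (b ℕ.∸ a) bs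
  next a as b [] | Data.Bool.false | Data.Bool.true = []
  next a as b (b₁ ∷ bs) | Data.Bool.false | Data.Bool.true = go i (suc j) (a ℕ.∸ b) as b₁ bs
  next a [] b bs | Data.Bool.false | Data.Bool.false = []
  next a (a₁ ∷ as) b [] | Data.Bool.false | Data.Bool.false = []
  next a (a₁ ∷ as) b (b₁ ∷ bs) | Data.Bool.false | Data.Bool.false = go (suc i) (suc j) a₁ as b₁ bs

greedyRun : List ℕ → List ℕ → List Assign
greedyRun [] _ = []
greedyRun (_ ∷ _) [] = []
greedyRun (a ∷ as) (b ∷ bs) = go 0 0 a as b bs

greedy : ∀ {n m} → (Fin n → ℕ) → (Fin m → ℕ) → Fin n → Fin m → ℕ
greedy a b i j = sumℕ (map val (greedyRun (vals a) (vals b)))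
  where
  val : Assign → ℕ
  val (i' , j' , v) = if (does (i' ℕ.≟ toℕ i) Data.Bool.∧ does (j' ℕ.≟ toℕ j)) then v else 0

cost : ∀ {n m} → (Fin n → ℚ) → (Fin n → Fin m → ℕ) → ℚ
cost {n} {m} f x =
  sumℚ (map (λ i → sumℚ (map (λ j → if 0 <ᵇ x i j then f i else 0ℚ) (allFin m))) (allFin n))

prefix : ∀ {n} → (Fin n → ℕ) → ℕ → ℕ
prefix a k = sumℕ (take k (vals a))

-- π(t) = smallest j ∈ {1..m} with b([j]) ≥ t  (0 if none; never happens for t ∈ (0, b([m])])
piB : ∀ {m} → (Fin m → ℕ) → ℕ → ℕ
piB {m} b t = fromMaybe 0 (head (filter (λ k → t ≤? prefix b k) (applyUpTo suc m)))

-- f extended with f_{n+1} = 0 ; argument k is the paper's 1-based index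
fAt : ∀ {n} → (Fin n → ℚ) → ℕ → ℚ
fAt f k = fromMaybe 0ℚ (head (Data.List.drop (k ℕ.∸ 1) (vals f)))

greedyBound : ∀ {n m} → (Fin n → ℕ) → (Fin n → ℚ) → (Fin m → ℕ) → ℚ
greedyBound {n} a f b =
  sumℚ (map (λ i → (fAt f i ℚ.- fAt f (suc i)) ℚ.* ℕ→ℚ (piB b (prefix a i))) (applyUpTo suc n))
  ℚ.+ sumℚ (map (λ i → fAt f i) (applyUpTo (λ k → k ℕ.+ 2) (n ℕ.∸ 1)))

-- Each step of the greedy run fills x_ij for the current pair (i, j) and then advances i, j or
-- both, so the steps serving sources 1 … i form a staircase that ends at a sink no later than
-- π(a([i])); there are C_i ≤ π(a([i])) + i - 1 of them.  Row i of x has at most c_i = C_i - C_{i-1}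
-- nonzero entries, so the cost is at most Σ_i f_i c_i, which by summation by parts (f_{n+1} = 0,
-- C_0 = 0) equals Σ_i (f_i - f_{i+1}) C_i.  As f_i - f_{i+1} ≥ 0, the bound on C_i gives
-- Σ_i (f_i - f_{i+1}) π(a([i])) + Σ_i (f_i - f_{i+1}) (i - 1), and a second summation by parts
-- turns the last sum into Σ_{i=2}^n f_i.
module Submission where

open import Algebra.Bundles using (CommutativeMonoid)
open import Data.Bool using (Bool; true; false; _∧_; if_then_else_)
open import Data.Fin using (Fin; toℕ)
import Data.Fin as Fin
open import Data.List using (List; []; _∷_; map; take; drop; head; filter; tabulate; allFin; applyUpTo; length)
open import Data.List.Properties using (map-cong; map-tabulate; map-applyUpTo; length-map; length-tabulate; take-all)
open import Data.List.Relation.Unary.All using (All; []; _∷_)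
import Data.List.Relation.Unary.All.Properties as All
open import Data.List.Relation.Unary.Any using (Any; here; there)
import Data.List.Relation.Unary.Any.Properties as Any
open import Data.Maybe using (just; fromMaybe)
open import Data.Nat using (ℕ; zero; suc; _<_; _≤_; z≤n; s≤s; z<s; s<s; _≤?_)
import Data.Nat as ℕ
import Data.Nat.Properties as ℕ
open import Data.Product using (_×_; _,_; ∃-syntax)
open import Data.Rational using (ℚ; 0ℚ; _*_; _-_; nonNegative) renaming (_≤_ to _≤ℚ_)
import Data.Rational.Properties as ℚ
open import Function using (_∘_; id)
open import Relation.Binary.PropositionalEquality
open import Relation.Nullary using (yes; no; contradiction)
open import Relation.Nullary.Reflects using (ofʸ; ofⁿ)
open import Relation.Unary using (Pred; Decidable)

open import Defs

module _ where
  open import Data.Nat using (_+_; _∸_; _<ᵇ_; _≡ᵇ_)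
  open import Algebra.Properties.CommutativeSemigroup ℕ.+-commutativeSemigroup
    using () renaming (interchange to +-interchange)
  open ℕ.≤-Reasoning

  𝟙 : Bool → ℕ
  𝟙 true  = 1
  𝟙 false = 0

  𝟙≤1 : ∀ c → 𝟙 c ≤ 1
  𝟙≤1 true  = s≤s z≤n
  𝟙≤1 false = z≤n

  𝟙+≤suc : ∀ c {x n} → x ≤ n → 𝟙 c + x ≤ suc n
  𝟙+≤suc c = ℕ.+-mono-≤ (𝟙≤1 c)

  𝟙-<ᵇ-suc : ∀ i K → 𝟙 (i <ᵇ suc K) ≡ 𝟙 (i <ᵇ K) + 𝟙 (i ≡ᵇ K)
  𝟙-<ᵇ-suc zero    zero    = refl
  𝟙-<ᵇ-suc zero    (suc K) = refl
  𝟙-<ᵇ-suc (suc i) zero    = refl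
  𝟙-<ᵇ-suc (suc i) (suc K) = 𝟙-<ᵇ-suc i K

  𝟙-<ᵇ-≥ : ∀ {i K} → K ≤ i → 𝟙 (i <ᵇ K) ≡ 0
  𝟙-<ᵇ-≥ {i} {K} K≤i with i <ᵇ K | ℕ.<ᵇ-reflects-< i K
  ... | true  | ofʸ i<K = contradiction K≤i (ℕ.<⇒≱ i<K)
  ... | false | _       = refl

  𝟙-positive-if-+ : ∀ c v w → 𝟙 (0 <ᵇ (if c then v else 0) + w) ≤ 𝟙 c + 𝟙 (0 <ᵇ w)
  𝟙-positive-if-+ false v       w = ℕ.≤-refl
  𝟙-positive-if-+ true  zero    w = ℕ.n≤1+n _
  𝟙-positive-if-+ true  (suc v) w = s≤s z≤n

  sum-applyUpTo-0 : ∀ m → sumℕ (applyUpTo (λ _ → 0) m) ≡ 0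
  sum-applyUpTo-0 zero    = refl
  sum-applyUpTo-0 (suc m) = sum-applyUpTo-0 m

  sum-applyUpTo-mono : ∀ m {g h : ℕ → ℕ} → (∀ j → g j ≤ h j) →
                       sumℕ (applyUpTo g m) ≤ sumℕ (applyUpTo h m)
  sum-applyUpTo-mono zero    g≤h = z≤n
  sum-applyUpTo-mono (suc m) g≤h = ℕ.+-mono-≤ (g≤h 0) (sum-applyUpTo-mono m (g≤h ∘ suc))

  sum-applyUpTo-+ : ∀ m (g h : ℕ → ℕ) →
                    sumℕ (applyUpTo (λ j → g j + h j) m) ≡ sumℕ (applyUpTo g m) + sumℕ (applyUpTo h m)
  sum-applyUpTo-+ zero    g h = refl
  sum-applyUpTo-+ (suc m) g h =
    trans (cong (g 0 + h 0 +_) (sum-applyUpTo-+ m (g ∘ suc) (h ∘ suc))) (+-interchange (g 0) (h 0) _ _)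

  sum-𝟙-≡ᵇ≤1 : ∀ j′ m → sumℕ (applyUpTo (λ j → 𝟙 (j′ ≡ᵇ j)) m) ≤ 1
  sum-𝟙-≡ᵇ≤1 j′       zero    = z≤n
  sum-𝟙-≡ᵇ≤1 zero     (suc m) = s≤s (ℕ.≤-reflexive (sum-applyUpTo-0 m))
  sum-𝟙-≡ᵇ≤1 (suc j′) (suc m) = sum-𝟙-≡ᵇ≤1 j′ m

  sum-𝟙-∧-≡ᵇ≤ : ∀ c j′ m → sumℕ (applyUpTo (λ j → 𝟙 (c ∧ (j′ ≡ᵇ j))) m) ≤ 𝟙 c
  sum-𝟙-∧-≡ᵇ≤ true  j′ m = sum-𝟙-≡ᵇ≤1 j′ m
  sum-𝟙-∧-≡ᵇ≤ false j′ m = ℕ.≤-reflexive (sum-applyUpTo-0 m)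

  sum-take≤sum : ∀ k xs → sumℕ (take k xs) ≤ sumℕ xs
  sum-take≤sum zero    xs       = z≤n
  sum-take≤sum (suc k) []       = z≤n
  sum-take≤sum (suc k) (x ∷ xs) = ℕ.+-monoʳ-≤ x (sum-take≤sum k xs)

  m+x≤n+y⇒x≤[n∸m]+y : ∀ {m n x y} → m ≤ n → m + x ≤ n + y → x ≤ (n ∸ m) + y
  m+x≤n+y⇒x≤[n∸m]+y {m} {n} {x} {y} m≤n le = ℕ.+-cancelˡ-≤ m x ((n ∸ m) + y) (begin
    m + x              ≤⟨ le ⟩
    n + y              ≡⟨ cong (_+ y) (ℕ.m+[n∸m]≡n m≤n) ⟨
    m + (n ∸ m) + y    ≡⟨ ℕ.+-assoc m (n ∸ m) y ⟩
    m + ((n ∸ m) + y)  ∎)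

  m+x≤n+y⇒[m∸n]+x≤y : ∀ {m n x y} → n ≤ m → m + x ≤ n + y → (m ∸ n) + x ≤ y
  m+x≤n+y⇒[m∸n]+x≤y {m} {n} {x} {y} n≤m le = ℕ.+-cancelˡ-≤ n ((m ∸ n) + x) y (begin
    n + ((m ∸ n) + x)  ≡⟨ ℕ.+-assoc n (m ∸ n) x ⟨
    n + (m ∸ n) + x    ≡⟨ cong (_+ x) (ℕ.m+[n∸m]≡n n≤m) ⟩
    m + x              ≤⟨ le ⟩
    n + y              ∎)

  m+x≤n+y⇒x≤y : ∀ {m n x y} → n ≤ m → m + x ≤ n + y → x ≤ y
  m+x≤n+y⇒x≤y {m} {n} {x} n≤m le = ℕ.≤-trans (ℕ.m≤n+m x (m ∸ n)) (m+x≤n+y⇒[m∸n]+x≤y n≤m le)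

  head-filter : ∀ {a p} {A : Set a} {P : Pred A p} (P? : Decidable P) xs → Any P xs →
                ∃[ y ] head (filter P? xs) ≡ just y × P y
  head-filter P? (x ∷ xs) Pxs with P? x
  ... | yes Px = x , refl , Px
  head-filter P? (x ∷ xs) (here Px)   | no ¬Px = contradiction Px ¬Px
  head-filter P? (x ∷ xs) (there Pxs) | no ¬Px = head-filter P? xs Pxs

  source : Assign → ℕ
  source (i , _ , _) = i

  countBelow : ℕ → List Assign → ℕ
  countBelow K []      = 0
  countBelow K (e ∷ R) = 𝟙 (source e <ᵇ K) + countBelow K R

  countAt : ℕ → List Assign → ℕ
  countAt K []      = 0
  countAt K (e ∷ R) = 𝟙 (source e ≡ᵇ K) + countAt K R

  countBelow-zero : ∀ R → countBelow 0 R ≡ 0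
  countBelow-zero []      = refl
  countBelow-zero (e ∷ R) = countBelow-zero R

  countBelow-suc : ∀ K R → countBelow (suc K) R ≡ countBelow K R + countAt K R
  countBelow-suc K []      = refl
  countBelow-suc K (e ∷ R) =
    trans (cong₂ _+_ (𝟙-<ᵇ-suc (source e) K) (countBelow-suc K R))
          (+-interchange (𝟙 (source e <ᵇ K)) (𝟙 (source e ≡ᵇ K)) (countBelow K R) (countAt K R))

  -- greedy a b i j is definitionally amount (toℕ i) (toℕ j) (greedyRun (vals a) (vals b)).
  amountAt : ℕ → ℕ → Assign → ℕ
  amountAt i j (i′ , j′ , v) = if (i′ ≡ᵇ i) ∧ (j′ ≡ᵇ j) then v else 0

  amount : ℕ → ℕ → List Assign → ℕ
  amount i j R = sumℕ (map (amountAt i j) R)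

  positives≤countAt : ∀ m R i → sumℕ (applyUpTo (λ j → 𝟙 (0 <ᵇ amount i j R)) m) ≤ countAt i R
  positives≤countAt m []                 i = ℕ.≤-reflexive (sum-applyUpTo-0 m)
  positives≤countAt m ((i′ , j′ , v) ∷ R) i = begin
    sumℕ (applyUpTo (λ j → 𝟙 (0 <ᵇ amountAt i j (i′ , j′ , v) + amount i j R)) m)
      ≤⟨ sum-applyUpTo-mono m (λ j → 𝟙-positive-if-+ ((i′ ≡ᵇ i) ∧ (j′ ≡ᵇ j)) v (amount i j R)) ⟩
    sumℕ (applyUpTo (λ j → 𝟙 ((i′ ≡ᵇ i) ∧ (j′ ≡ᵇ j)) + 𝟙 (0 <ᵇ amount i j R)) m)
      ≡⟨ sum-applyUpTo-+ m _ _ ⟩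
    sumℕ (applyUpTo (λ j → 𝟙 ((i′ ≡ᵇ i) ∧ (j′ ≡ᵇ j))) m) + sumℕ (applyUpTo (λ j → 𝟙 (0 <ᵇ amount i j R)) m)
      ≤⟨ ℕ.+-mono-≤ (sum-𝟙-∧-≡ᵇ≤ (i′ ≡ᵇ i) j′ m) (positives≤countAt m R i) ⟩
    𝟙 (i′ ≡ᵇ i) + countAt i R ∎

  i+1≡K⇒K≤1+i : ∀ {i K} → i + 1 ≡ K → K ≤ suc i
  i+1≡K⇒K≤1+i {i} K≡ = ℕ.≤-reflexive (trans (sym K≡) (ℕ.+-comm i 1))

  countBelow-go≡0 : ∀ {K} i j a as b bs → K ≤ i → countBelow K (go i j a as b bs) ≡ 0
  countBelow-go≡0 i j a as b bs K≤i with a <ᵇ b | b <ᵇ a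
  countBelow-go≡0 i j a []        b bs        K≤i | true  | _     = cong (_+ 0) (𝟙-<ᵇ-≥ K≤i)
  countBelow-go≡0 i j a (a₁ ∷ as) b bs        K≤i | true  | _     =
    cong₂ _+_ (𝟙-<ᵇ-≥ K≤i) (countBelow-go≡0 (suc i) j a₁ as (b ∸ a) bs (ℕ.m≤n⇒m≤1+n K≤i))
  countBelow-go≡0 i j a as        b []        K≤i | false | true  = cong (_+ 0) (𝟙-<ᵇ-≥ K≤i)
  countBelow-go≡0 i j a as        b (b₁ ∷ bs) K≤i | false | true  =
    cong₂ _+_ (𝟙-<ᵇ-≥ K≤i) (countBelow-go≡0 i (suc j) (a ∸ b) as b₁ bs K≤i)
  countBelow-go≡0 i j a []        b bs        K≤i | false | false = cong (_+ 0) (𝟙-<ᵇ-≥ K≤i)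
  countBelow-go≡0 i j a (a₁ ∷ as) b []        K≤i | false | false = cong (_+ 0) (𝟙-<ᵇ-≥ K≤i)
  countBelow-go≡0 i j a (a₁ ∷ as) b (b₁ ∷ bs) K≤i | false | false =
    cong₂ _+_ (𝟙-<ᵇ-≥ K≤i) (countBelow-go≡0 (suc i) (suc j) a₁ as b₁ bs (ℕ.m≤n⇒m≤1+n K≤i))

  -- The remaining supply of sources i … i+k is at most the remaining demand of sinks j … j+p, so
  -- the run cannot move past sink j+p while serving these sources; since every step advances the
  -- source, the sink or both, it spends at most (k+1) + (p+1) - 1 steps on them.
  countBelow-go≤ : ∀ K i j a as b bs k p → i + suc k ≡ K → All (0 <_) as →
                   a + sumℕ (take k as) ≤ b + sumℕ (take p bs) →
                   countBelow K (go i j a as b bs) ≤ suc (p + k)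
  countBelow-go≤ K i j a as b bs k p K≡ as>0 inv
    with a <ᵇ b | ℕ.<ᵇ-reflects-< a b | b <ᵇ a | ℕ.<ᵇ-reflects-< b a
  countBelow-go≤ K i j a [] b bs k p _ _ _ | true | _ | _ | _ = 𝟙+≤suc (i <ᵇ K) z≤n
  countBelow-go≤ K i j a (a₁ ∷ as) b bs zero p K≡ _ _ | true | _ | _ | _ =
    𝟙+≤suc (i <ᵇ K) (ℕ.≤-trans (ℕ.≤-reflexive (countBelow-go≡0 (suc i) j a₁ as (b ∸ a) bs (i+1≡K⇒K≤1+i K≡))) z≤n)
  countBelow-go≤ K i j a (a₁ ∷ as) b bs (suc k) p K≡ (_ ∷ as>0) inv | true | ofʸ a<b | _ | _ =
    ℕ.≤-trans
      (𝟙+≤suc (i <ᵇ K) (countBelow-go≤ K (suc i) j a₁ as (b ∸ a) bs k p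
        (trans (sym (ℕ.+-suc i (suc k))) K≡) as>0 (m+x≤n+y⇒x≤[n∸m]+y (ℕ.<⇒≤ a<b) inv)))
      (ℕ.≤-reflexive (cong suc (sym (ℕ.+-suc p k))))
  countBelow-go≤ K i j a as b [] k p _ _ _ | false | _ | true | _ = 𝟙+≤suc (i <ᵇ K) z≤n
  countBelow-go≤ K i j a as b (b₁ ∷ bs) k zero _ _ inv | false | _ | true | ofʸ b<a =
    contradiction (ℕ.m+n≤o⇒m≤o a (subst (a + sumℕ (take k as) ≤_) (ℕ.+-identityʳ b) inv)) (ℕ.<⇒≱ b<a)
  countBelow-go≤ K i j a as b (b₁ ∷ bs) k (suc p) K≡ as>0 inv | false | _ | true | ofʸ b<a =
    𝟙+≤suc (i <ᵇ K) (countBelow-go≤ K i (suc j) (a ∸ b) as b₁ bs k p K≡ as>0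
      (m+x≤n+y⇒[m∸n]+x≤y (ℕ.<⇒≤ b<a) inv))
  countBelow-go≤ K i j a [] b bs k p _ _ _ | false | _ | false | _ = 𝟙+≤suc (i <ᵇ K) z≤n
  countBelow-go≤ K i j a (a₁ ∷ as) b [] k p _ _ _ | false | _ | false | _ = 𝟙+≤suc (i <ᵇ K) z≤n
  countBelow-go≤ K i j a (a₁ ∷ as) b (b₁ ∷ bs) zero p K≡ _ _ | false | _ | false | _ =
    𝟙+≤suc (i <ᵇ K) (ℕ.≤-trans (ℕ.≤-reflexive (countBelow-go≡0 (suc i) (suc j) a₁ as b₁ bs (i+1≡K⇒K≤1+i K≡))) z≤n)
  countBelow-go≤ K i j a (a₁ ∷ as) b (b₁ ∷ bs) (suc k) zero K≡ (a₁>0 ∷ _) inv | false | ofⁿ a≮b | false | _ =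
    contradiction (ℕ.≤-trans (ℕ.m≤m+n a₁ _) (m+x≤n+y⇒x≤y (ℕ.≮⇒≥ a≮b) inv)) (ℕ.<⇒≱ a₁>0)
  countBelow-go≤ K i j a (a₁ ∷ as) b (b₁ ∷ bs) (suc k) (suc p) K≡ (_ ∷ as>0) inv | false | ofⁿ a≮b | false | _ =
    𝟙+≤suc (i <ᵇ K) (ℕ.≤-trans
      (countBelow-go≤ K (suc i) (suc j) a₁ as b₁ bs k p (trans (sym (ℕ.+-suc i (suc k))) K≡) as>0
        (m+x≤n+y⇒x≤y (ℕ.≮⇒≥ a≮b) inv))
      (s≤s (ℕ.+-monoʳ-≤ p (ℕ.n≤1+n k))))

  countBelow-greedyRun≤ : ∀ as bs t p → All (0 <_) as →
                          sumℕ (take (suc t) as) ≤ sumℕ (take (suc p) bs) →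
                          countBelow (suc t) (greedyRun as bs) ≤ suc p + t
  countBelow-greedyRun≤ []       bs       t p _            _   = z≤n
  countBelow-greedyRun≤ (a ∷ as) []       t p _            _   = z≤n
  countBelow-greedyRun≤ (a ∷ as) (b ∷ bs) t p (_ ∷ as>0) inv =
    countBelow-go≤ (suc t) 0 0 a as b bs t p refl as>0 inv

  prefix-total : ∀ {m} (b : Fin m → ℕ) → prefix b m ≡ sumℕ (vals b)
  prefix-total {m} b = cong sumℕ (take-all m (vals b) (ℕ.≤-reflexive length-vals))
    where
    length-vals : length (vals b) ≡ m
    length-vals = trans (length-map b (allFin m)) (length-tabulate id)

  piB-covers : ∀ {m} (b : Fin m → ℕ) t → 0 < t → t ≤ sumℕ (vals b) →
               ∃[ p ] piB b t ≡ suc p × t ≤ prefix b (suc p)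
  piB-covers {zero}  b t t>0 t≤0 = contradiction t≤0 (ℕ.<⇒≱ t>0)
  piB-covers {suc m} b t t>0 t≤Σb
    with head-filter (λ k → t ≤? prefix b k) (applyUpTo suc (suc m))
           (Any.applyUpTo⁺ suc (subst (t ≤_) (sym (prefix-total b)) t≤Σb) (ℕ.n<1+n m))
  ... | zero  , _     , t≤0 = contradiction t≤0 (ℕ.<⇒≱ t>0)
  ... | suc p , first , t≤  = p , cong (fromMaybe 0) first , t≤

  greedy-countBelow≤ : ∀ {n m} (a : Fin n → ℕ) (b : Fin m → ℕ) →
                       (∀ i → 0 < a i) → sumℕ (vals a) ≡ sumℕ (vals b) → ∀ t → t < n →
                       countBelow (suc t) (greedyRun (vals a) (vals b)) ≤ piB b (prefix a (suc t)) + t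
  greedy-countBelow≤ {suc n} a b a>0 Σa≡Σb t _
    with piB-covers b (prefix a (suc t)) (ℕ.<-≤-trans (a>0 Fin.zero) (ℕ.m≤m+n _ _))
           (ℕ.≤-trans (sum-take≤sum (suc t) (vals a)) (ℕ.≤-reflexive Σa≡Σb))
  ... | p , π≡ , covers rewrite π≡ =
    countBelow-greedyRun≤ (vals a) (vals b) t p (All.map⁺ (All.tabulate⁺ a>0)) covers

module _ where
  import Data.Integer as ℤ
  import Data.Integer.Properties as ℤ
  import Data.Nat.Coprimality as Coprime
  open import Data.Nat using (_<ᵇ_)
  open import Data.Rational using (_+_; -_; _/_; 1ℚ; mkℚ)
  open import Data.Rational.Solver using (module +-*-Solver)
  open import Algebra.Properties.CommutativeSemigroup (CommutativeMonoid.commutativeSemigroup ℚ.+-0-commutativeMonoid)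
    using () renaming (interchange to +-interchange)

  ℕ→ℚ≡mkℚ : ∀ k → ℕ→ℚ k ≡ mkℚ (ℤ.+ k) 0 (Coprime.sym (Coprime.1-coprimeTo k))
  ℕ→ℚ≡mkℚ k = ℚ.normalize-coprime _

  ℕ→ℚ-+ : ∀ k l → ℕ→ℚ (k ℕ.+ l) ≡ ℕ→ℚ k + ℕ→ℚ l
  ℕ→ℚ-+ k l rewrite ℕ→ℚ≡mkℚ k | ℕ→ℚ≡mkℚ l =
    cong₂ (λ x y → (x ℤ.+ y) / 1) (sym (ℤ.*-identityʳ (ℤ.+ k))) (sym (ℤ.*-identityʳ (ℤ.+ l)))

  ℕ→ℚ-suc : ∀ k → ℕ→ℚ (suc k) ≡ ℕ→ℚ k + 1ℚ
  ℕ→ℚ-suc k = trans (cong ℕ→ℚ (ℕ.+-comm 1 k)) (ℕ→ℚ-+ k 1)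

  ℕ→ℚ-nonNeg : ∀ k → 0ℚ ≤ℚ ℕ→ℚ k
  ℕ→ℚ-nonNeg k = ℚ.nonNegative⁻¹ (ℕ→ℚ k) {{ℚ.normalize-nonNeg k 1}}

  ℕ→ℚ-mono-≤ : ∀ {k l} → k ≤ l → ℕ→ℚ k ≤ℚ ℕ→ℚ l
  ℕ→ℚ-mono-≤ {k} {l} k≤l = begin
    ℕ→ℚ k                      ≡⟨ ℚ.+-identityʳ _ ⟨
    ℕ→ℚ k + 0ℚ                 ≤⟨ ℚ.+-monoʳ-≤ (ℕ→ℚ k) (ℕ→ℚ-nonNeg (l ℕ.∸ k)) ⟩
    ℕ→ℚ k + ℕ→ℚ (l ℕ.∸ k)      ≡⟨ ℕ→ℚ-+ k (l ℕ.∸ k) ⟨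
    ℕ→ℚ (k ℕ.+ (l ℕ.∸ k))      ≡⟨ cong ℕ→ℚ (ℕ.m+[n∸m]≡n k≤l) ⟩
    ℕ→ℚ l                      ∎
    where open ℚ.≤-Reasoning

  p≤q⇒0≤q-p : ∀ {p q} → p ≤ℚ q → 0ℚ ≤ℚ q - p
  p≤q⇒0≤q-p {p} {q} p≤q = subst (_≤ℚ q - p) (ℚ.+-inverseʳ p) (ℚ.+-monoˡ-≤ (- p) p≤q)

  sumℚ-map-mono : ∀ {A : Set} {g h : A → ℚ} xs → (∀ x → g x ≤ℚ h x) →
                  sumℚ (map g xs) ≤ℚ sumℚ (map h xs)
  sumℚ-map-mono []       g≤h = ℚ.≤-refl
  sumℚ-map-mono (x ∷ xs) g≤h = ℚ.+-mono-≤ (g≤h x) (sumℚ-map-mono xs g≤h)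

  map-allFin-toℕ : ∀ {A : Set} n (g : ℕ → A) → map (g ∘ toℕ) (allFin n) ≡ applyUpTo g n
  map-allFin-toℕ n g = trans (map-tabulate id (g ∘ toℕ)) (tabulate-toℕ n g)
    where
    tabulate-toℕ : ∀ n (g : ℕ → _) → tabulate {n = n} (g ∘ toℕ) ≡ applyUpTo g n
    tabulate-toℕ zero    g = refl
    tabulate-toℕ (suc n) g = cong (g 0 ∷_) (tabulate-toℕ n (g ∘ suc))

  sum-if≡*count : ∀ q (B : ℕ → Bool) m →
                  sumℚ (applyUpTo (λ j → if B j then q else 0ℚ) m) ≡ q * ℕ→ℚ (sumℕ (applyUpTo (𝟙 ∘ B) m))
  sum-if≡*count q B zero    = sym (ℚ.*-zeroʳ q)
  sum-if≡*count q B (suc m) with B 0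
  ... | false = trans (ℚ.+-identityˡ _) (sum-if≡*count q (B ∘ suc) m)
  ... | true  = begin
    q + sumℚ (applyUpTo (λ j → if B (suc j) then q else 0ℚ) m)  ≡⟨ cong (q +_) (sum-if≡*count q (B ∘ suc) m) ⟩
    q + q * N                                                    ≡⟨ cong (_+ q * N) (ℚ.*-identityʳ q) ⟨
    q * 1ℚ + q * N                                               ≡⟨ ℚ.*-distribˡ-+ q 1ℚ N ⟨
    q * (1ℚ + N)                                                 ≡⟨ cong (q *_) (ℕ→ℚ-+ 1 (sumℕ (applyUpTo (𝟙 ∘ B ∘ suc) m))) ⟨
    q * ℕ→ℚ (suc (sumℕ (applyUpTo (𝟙 ∘ B ∘ suc) m)))             ∎
    where
    open ≡-Reasoning
    N = ℕ→ℚ (sumℕ (applyUpTo (𝟙 ∘ B ∘ suc) m))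

  ∑< : ℕ → (ℕ → ℚ) → ℚ
  ∑< n g = sumℚ (applyUpTo g n)

  syntax ∑< n (λ t → g) = ∑[ t < n ] g

  ∑-cong : ∀ n {g h : ℕ → ℚ} → (∀ t → g t ≡ h t) → ∑< n g ≡ ∑< n h
  ∑-cong zero    g≗h = refl
  ∑-cong (suc n) g≗h = cong₂ _+_ (g≗h 0) (∑-cong n (g≗h ∘ suc))

  ∑-mono-≤ : ∀ n {g h : ℕ → ℚ} → (∀ t → t < n → g t ≤ℚ h t) → ∑< n g ≤ℚ ∑< n h
  ∑-mono-≤ zero    g≤h = ℚ.≤-refl
  ∑-mono-≤ (suc n) g≤h = ℚ.+-mono-≤ (g≤h 0 z<s) (∑-mono-≤ n (λ t t<n → g≤h (suc t) (s<s t<n)))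

  ∑-distrib-+ : ∀ n (g h : ℕ → ℚ) → ∑[ t < n ] (g t + h t) ≡ ∑< n g + ∑< n h
  ∑-distrib-+ zero    g h = sym (ℚ.+-identityʳ 0ℚ)
  ∑-distrib-+ (suc n) g h = trans (cong (g 0 + h 0 +_) (∑-distrib-+ n (g ∘ suc) (h ∘ suc)))
    (+-interchange (g 0) (h 0) (∑< n (g ∘ suc)) (∑< n (h ∘ suc)))

  summation-by-parts : ∀ n (ψ c C : ℕ → ℚ) → (∀ t → C (suc t) ≡ C t + c t) →
    ∑[ t < n ] (ψ t * c t) + ψ 0 * C 0 ≡ ∑[ t < n ] ((ψ t - ψ (suc t)) * C (suc t)) + ψ n * C n
  summation-by-parts zero    ψ c C C-suc = refl
  summation-by-parts (suc n) ψ c C C-suc = begin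
    (ψ 0 * c 0 + S) + ψ 0 * C 0
      ≡⟨ solve 5 (λ p q x y s → (p :* y :+ s) :+ p :* x := (p :- q) :* (x :+ y) :+ (s :+ q :* (x :+ y))) refl
                 (ψ 0) (ψ 1) (C 0) (c 0) S ⟩
    (ψ 0 - ψ 1) * (C 0 + c 0) + (S + ψ 1 * (C 0 + c 0))
      ≡⟨ cong (λ x → (ψ 0 - ψ 1) * x + (S + ψ 1 * x)) (C-suc 0) ⟨
    (ψ 0 - ψ 1) * C 1 + (S + ψ 1 * C 1)
      ≡⟨ cong ((ψ 0 - ψ 1) * C 1 +_) (summation-by-parts n (ψ ∘ suc) (c ∘ suc) (C ∘ suc) (C-suc ∘ suc)) ⟩
    (ψ 0 - ψ 1) * C 1 + (∑[ t < n ] ((ψ (suc t) - ψ (suc (suc t))) * C (suc (suc t))) + ψ (suc n) * C (suc n))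
      ≡⟨ ℚ.+-assoc ((ψ 0 - ψ 1) * C 1) _ (ψ (suc n) * C (suc n)) ⟨
    ∑[ t < suc n ] ((ψ t - ψ (suc t)) * C (suc t)) + ψ (suc n) * C (suc n) ∎
    where
    open ≡-Reasoning
    open +-*-Solver
    S = ∑[ t < n ] (ψ (suc t) * c (suc t))

  summation-by-parts₀ : ∀ n (ψ c C : ℕ → ℚ) → (∀ t → C (suc t) ≡ C t + c t) → C 0 ≡ 0ℚ → ψ n ≡ 0ℚ →
    ∑[ t < n ] (ψ t * c t) ≡ ∑[ t < n ] ((ψ t - ψ (suc t)) * C (suc t))
  summation-by-parts₀ n ψ c C C-suc C0≡0 ψn≡0 = begin
    L                   ≡⟨ ℚ.+-identityʳ L ⟨
    L + 0ℚ              ≡⟨ cong (L +_) ψ0C0≡0 ⟨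
    L + ψ 0 * C 0       ≡⟨ summation-by-parts n ψ c C C-suc ⟩
    R + ψ n * C n       ≡⟨ cong (R +_) ψnCn≡0 ⟩
    R + 0ℚ              ≡⟨ ℚ.+-identityʳ R ⟩
    R                   ∎
    where
    open ≡-Reasoning
    L = ∑[ t < n ] (ψ t * c t)
    R = ∑[ t < n ] ((ψ t - ψ (suc t)) * C (suc t))
    ψ0C0≡0 = trans (cong (ψ 0 *_) C0≡0) (ℚ.*-zeroʳ (ψ 0))
    ψnCn≡0 = trans (cong (_* C n) ψn≡0) (ℚ.*-zeroˡ (C n))

  ∑-differences-*-index : ∀ n (ψ : ℕ → ℚ) → ψ n ≡ 0ℚ →
    ∑[ t < n ] ((ψ t - ψ (suc t)) * ℕ→ℚ t) ≡ ∑[ t < n ℕ.∸ 1 ] ψ (suc t)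
  ∑-differences-*-index zero    ψ _     = refl
  ∑-differences-*-index (suc n) ψ ψn≡0 = begin
    (ψ 0 - ψ 1) * 0ℚ + S  ≡⟨ cong (_+ S) (ℚ.*-zeroʳ (ψ 0 - ψ 1)) ⟩
    0ℚ + S                ≡⟨ ℚ.+-identityˡ S ⟩
    S                     ≡⟨ summation-by-parts₀ n (ψ ∘ suc) (λ _ → 1ℚ) ℕ→ℚ ℕ→ℚ-suc refl ψn≡0 ⟨
    ∑[ t < n ] (ψ (suc t) * 1ℚ)
                          ≡⟨ ∑-cong n (ℚ.*-identityʳ ∘ ψ ∘ suc) ⟩
    ∑[ t < n ] ψ (suc t)  ∎
    where
    open ≡-Reasoning
    S = ∑[ t < n ] ((ψ (suc t) - ψ (suc (suc t))) * ℕ→ℚ (suc t))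

  vals-suc : ∀ {n} {A : Set} (f : Fin (suc n) → A) → vals f ≡ f Fin.zero ∷ vals (f ∘ Fin.suc)
  vals-suc f = cong (f Fin.zero ∷_) (trans (map-tabulate Fin.suc f) (sym (map-tabulate id (f ∘ Fin.suc))))

  fAt-suc : ∀ {n} (f : Fin (suc n) → ℚ) t → fAt f (suc (suc t)) ≡ fAt (f ∘ Fin.suc) (suc t)
  fAt-suc f t = cong (λ xs → fromMaybe 0ℚ (head (drop (suc t) xs))) (vals-suc f)

  fAt-toℕ : ∀ {n} (f : Fin n → ℚ) i → fAt f (suc (toℕ i)) ≡ f i
  fAt-toℕ f Fin.zero    = refl
  fAt-toℕ f (Fin.suc i) = trans (fAt-suc f (toℕ i)) (fAt-toℕ (f ∘ Fin.suc) i)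

  fAt-beyond : ∀ {n} (f : Fin n → ℚ) → fAt f (suc n) ≡ 0ℚ
  fAt-beyond {zero}  f = refl
  fAt-beyond {suc n} f = trans (fAt-suc f n) (fAt-beyond (f ∘ Fin.suc))

  fAt-antitone : ∀ {n} (f : Fin n → ℚ) → (∀ i → 0ℚ ≤ℚ f i) → (∀ i i′ → i Fin.≤ i′ → f i′ ≤ℚ f i) →
                 ∀ t → fAt f (suc (suc t)) ≤ℚ fAt f (suc t)
  fAt-antitone {zero}        f f≥0 f↓ zero    = ℚ.≤-refl
  fAt-antitone {zero}        f f≥0 f↓ (suc t) = ℚ.≤-refl
  fAt-antitone {suc zero}    f f≥0 f↓ zero    = f≥0 Fin.zero
  fAt-antitone {suc (suc n)} f f≥0 f↓ zero    = f↓ Fin.zero (Fin.suc Fin.zero) z≤n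
  fAt-antitone {suc n}       f f≥0 f↓ (suc t) =
    subst₂ _≤ℚ_ (sym (fAt-suc f (suc t))) (sym (fAt-suc f t))
      (fAt-antitone (f ∘ Fin.suc) (f≥0 ∘ Fin.suc) (λ i i′ → f↓ (Fin.suc i) (Fin.suc i′) ∘ s≤s) t)

  cost≤∑-countAt : ∀ {n} m (f : Fin n → ℚ) R → (∀ i → 0ℚ ≤ℚ f i) →
    cost {n} {m} f (λ i j → amount (toℕ i) (toℕ j) R) ≤ℚ ∑[ t < n ] (fAt f (suc t) * ℕ→ℚ (countAt t R))
  cost≤∑-countAt {n} m f R f≥0 = begin
    cost {n} {m} f (λ i j → amount (toℕ i) (toℕ j) R)
      ≤⟨ sumℚ-map-mono (allFin n) row≤ ⟩
    sumℚ (map (λ i → f i * ℕ→ℚ (countAt (toℕ i) R)) (allFin n))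
      ≡⟨ cong sumℚ (trans (map-cong (λ i → cong (_* ℕ→ℚ (countAt (toℕ i) R)) (sym (fAt-toℕ f i))) (allFin n))
                          (map-allFin-toℕ n (λ t → fAt f (suc t) * ℕ→ℚ (countAt t R)))) ⟩
    ∑[ t < n ] (fAt f (suc t) * ℕ→ℚ (countAt t R)) ∎
    where
    open ℚ.≤-Reasoning
    row≤ : ∀ i → sumℚ (map (λ j → if 0 <ᵇ amount (toℕ i) (toℕ j) R then f i else 0ℚ) (allFin m))
                 ≤ℚ f i * ℕ→ℚ (countAt (toℕ i) R)
    row≤ i = begin
      sumℚ (map (λ j → if 0 <ᵇ amount (toℕ i) (toℕ j) R then f i else 0ℚ) (allFin m))
        ≡⟨ cong sumℚ (map-allFin-toℕ m (λ j → if 0 <ᵇ amount (toℕ i) j R then f i else 0ℚ)) ⟩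
      sumℚ (applyUpTo (λ j → if 0 <ᵇ amount (toℕ i) j R then f i else 0ℚ) m)
        ≡⟨ sum-if≡*count (f i) (λ j → 0 <ᵇ amount (toℕ i) j R) m ⟩
      f i * ℕ→ℚ (sumℕ (applyUpTo (λ j → 𝟙 (0 <ᵇ amount (toℕ i) j R)) m))
        ≤⟨ ℚ.*-monoˡ-≤-nonNeg (f i) {{nonNegative (f≥0 i)}} (ℕ→ℚ-mono-≤ (positives≤countAt m R (toℕ i))) ⟩
      f i * ℕ→ℚ (countAt (toℕ i) R) ∎

  ∑-countAt-by-parts : ∀ n (ψ : ℕ → ℚ) R → ψ n ≡ 0ℚ →
    ∑[ t < n ] (ψ t * ℕ→ℚ (countAt t R)) ≡ ∑[ t < n ] ((ψ t - ψ (suc t)) * ℕ→ℚ (countBelow (suc t) R))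
  ∑-countAt-by-parts n ψ R = summation-by-parts₀ n ψ (λ t → ℕ→ℚ (countAt t R)) (λ t → ℕ→ℚ (countBelow t R))
    (λ t → trans (cong ℕ→ℚ (countBelow-suc t R)) (ℕ→ℚ-+ (countBelow t R) (countAt t R)))
    (cong ℕ→ℚ (countBelow-zero R))

  greedyBound≡∑ : ∀ {n m} (a : Fin n → ℕ) (f : Fin n → ℚ) (b : Fin m → ℕ) →
    greedyBound a f b ≡
    ∑[ t < n ] ((fAt f (suc t) - fAt f (suc (suc t))) * ℕ→ℚ (piB b (prefix a (suc t)) ℕ.+ t))
  greedyBound≡∑ {n} a f b = begin
    greedyBound a f b
      ≡⟨ cong₂ _+_ (cong sumℚ (map-applyUpTo suc _ n))
                   (trans (cong sumℚ (map-applyUpTo (ℕ._+ 2) (fAt f) (n ℕ.∸ 1)))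
                          (∑-cong (n ℕ.∸ 1) (λ t → cong (fAt f) (ℕ.+-comm t 2)))) ⟩
    ∑[ t < n ] (d t * P t) + ∑[ t < n ℕ.∸ 1 ] ψ (suc t)
      ≡⟨ cong (∑[ t < n ] (d t * P t) +_) (∑-differences-*-index n ψ (fAt-beyond f)) ⟨
    ∑[ t < n ] (d t * P t) + ∑[ t < n ] (d t * ℕ→ℚ t)
      ≡⟨ ∑-distrib-+ n (λ t → d t * P t) (λ t → d t * ℕ→ℚ t) ⟨
    ∑[ t < n ] (d t * P t + d t * ℕ→ℚ t)
      ≡⟨ ∑-cong n (λ t → trans (sym (ℚ.*-distribˡ-+ (d t) (P t) (ℕ→ℚ t)))
                               (cong (d t *_) (sym (ℕ→ℚ-+ (piB b (prefix a (suc t))) t)))) ⟩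
    ∑[ t < n ] (d t * ℕ→ℚ (piB b (prefix a (suc t)) ℕ.+ t)) ∎
    where
    open ≡-Reasoning
    ψ : ℕ → ℚ
    ψ t = fAt f (suc t)
    d : ℕ → ℚ
    d t = ψ t - ψ (suc t)
    P : ℕ → ℚ
    P t = ℕ→ℚ (piB b (prefix a (suc t)))

lemma4p3 : (n m : ℕ) (a : Fin n → ℕ) (f : Fin n → ℚ) (b : Fin m → ℕ)
    → (∀ i → 0 < a i)
    → (∀ i → 0ℚ ≤ℚ f i)
    → (∀ i i' → i Data.Fin.≤ i' → f i' ≤ℚ f i)
    → (∀ j → 0 < b j)
    → (∀ j j' → j Data.Fin.≤ j' → b j' Data.Nat.≤ b j)
    → sumℕ (vals a) ≡ sumℕ (vals b)
    → cost f (greedy a b) ≤ℚ greedyBound a f b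
-- The demands need not be positive or sorted.
lemma4p3 n m a f b a>0 f≥0 f↓ _ _ Σa≡Σb = begin
    cost f (greedy a b)
  ≤⟨ cost≤∑-countAt m f R f≥0 ⟩
    ∑[ t < n ] (ψ t * ℕ→ℚ (countAt t R))
  ≡⟨ ∑-countAt-by-parts n ψ R (fAt-beyond f) ⟩
    ∑[ t < n ] (d t * ℕ→ℚ (countBelow (suc t) R))
  ≤⟨ ∑-mono-≤ n (λ t t<n → ℚ.*-monoˡ-≤-nonNeg (d t) {{nonNegative (d≥0 t)}}
                             (ℕ→ℚ-mono-≤ (greedy-countBelow≤ a b a>0 Σa≡Σb t t<n))) ⟩
    ∑[ t < n ] (d t * ℕ→ℚ (piB b (prefix a (suc t)) ℕ.+ t))
  ≡⟨ greedyBound≡∑ a f b ⟨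
    greedyBound a f b ∎
  where
  open ℚ.≤-Reasoning
  -- Indices are 0-based: ψ t is f_{t+1}, and countBelow (suc t) R is C_{t+1}.
  R = greedyRun (vals a) (vals b)
  ψ : ℕ → ℚ
  ψ t = fAt f (suc t)
  d : ℕ → ℚ
  d t = ψ t - ψ (suc t)
  d≥0 : ∀ t → 0ℚ ≤ℚ d t
  d≥0 t = p≤q⇒0≤q-p (fAt-antitone f f≥0 f↓ t)
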